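{- For every positive integer $k$ and every graph $G$ of degeneracy $d$, there is a maximal collection $\mathcal{C}$ of pairwise edge-disjoint $k$-stars in $G$ such that each vertex of $G$ is an endvertex of at most $d+k-1$ stars in $\mathcal{C}$.
   Context: All graphs are finite and simple. A $k$-star is a subgraph isomorphic to $K_{1,k}$; it has a central vertex of degree $k$ and $k$ endvertices (leaves). A collection of edge-disjoint $k$-stars in $G$ is maximal if no further $k$-star in $G$ edge-disjoint from all of them can be added. The degeneracy of $G$ is the maximum of the minimum degree $\delta(G')$ over all non-empty induced subgraphs $G'$ of $G$. -}

module Defs where

open import Data.Nat using (ℕ; _≤_)
open import Data.Bool using (Bool; true; false; _∧_; if_then_else_)
open import Data.Fin using (Fin)
open import Data.Fin.Properties using (_≟_)
open import Data.Vec using (Vec; lookup)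
open import Data.List using (List; length; filter; filterᵇ; allFin; map; sum)
open import Data.List.Relation.Unary.All using (All)
open import Data.List.Relation.Unary.AllPairs using (AllPairs)
open import Data.Product using (_×_; ∃; ∃-syntax; _,_)
open import Data.Sum using (_⊎_)
open import Relation.Binary.PropositionalEquality using (_≡_; _≢_)
open import Relation.Nullary using (¬_)
import Data.Vec.Membership.DecPropositional as VD
import Data.Vec.Membership.Propositional as VM

record Graph (n : ℕ) : Set where
  field
    adj    : Fin n → Fin n → Bool
    sym    : ∀ u v → adj u v ≡ adj v u
    irrefl : ∀ v → adj v v ≡ false
open Graph public

-- Vertex subsets (induced subgraphs) as Boolean characteristic vectors.
VSet : ℕ → Set
VSet n = Vec Bool n

_∈S_ : ∀ {n} → Fin n → VSet n → Set
v ∈S S = lookup S v ≡ true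

NonEmpty : ∀ {n} → VSet n → Set
NonEmpty S = ∃[ v ] (v ∈S S)

degIn : ∀ {n} → Graph n → VSet n → Fin n → ℕ
degIn {n} G S v = length (filterᵇ (λ u → lookup S u ∧ adj G v u) (allFin n))

-- d is the degeneracy of G: the maximum over non-empty induced subgraphs G[S]
-- of the minimum degree δ(G[S]).
IsDegeneracy : ∀ {n} → Graph n → ℕ → Set
IsDegeneracy {n} G d =
  (∀ (S : VSet n) → NonEmpty S → ∃[ v ] (v ∈S S × degIn G S v ≤ d))
  × (∃[ S ] (NonEmpty S × (∀ v → v ∈S S → d ≤ degIn G S v)))

record Star {n} (G : Graph n) (k : ℕ) : Set where
  constructor star
  field
    centre   : Fin n
    leaves   : Vec (Fin n) k
    distinct : ∀ i j → lookup leaves i ≡ lookup leaves j → i ≡ j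
    isAdj    : ∀ i → adj G centre (lookup leaves i) ≡ true
open Star public

SameEdge : ∀ {n} → Fin n → Fin n → Fin n → Fin n → Set
SameEdge a b c e = (a ≡ c × b ≡ e) ⊎ (a ≡ e × b ≡ c)

EdgeDisjoint : ∀ {n} {G : Graph n} {k} → Star G k → Star G k → Set
EdgeDisjoint s t =
  ∀ i j → ¬ SameEdge (centre s) (lookup (leaves s) i) (centre t) (lookup (leaves t) j)

PairwiseEdgeDisjoint : ∀ {n} {G : Graph n} {k} → List (Star G k) → Set
PairwiseEdgeDisjoint C = AllPairs EdgeDisjoint C

Maximal : ∀ {n} {G : Graph n} {k} → List (Star G k) → Set
Maximal {G = G} {k} C = ∀ (s : Star G k) → ¬ All (EdgeDisjoint s) C

endCount : ∀ {n} {G : Graph n} {k} → Fin n → List (Star G k) → ℕ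
endCount {n} v C = length (filter (λ s → VD._∈?_ (_≟_ {n}) v (leaves s)) C)

module Submission where

-- We add
-- the vertices one at a time in the reverse of a degeneracy order: the vertex v
-- processed last in G[S] has at most d neighbours in S.  Having built a
-- collection C for S - v, we group the neighbours w of v whose edge vw is still
-- free into disjoint k-stars centred at v (a "fan"), leaving fewer than k free
-- edges at v.  Each vertex v then carries a certificate (`Witness`): a list of at
-- most d "earlier" neighbours and fewer than k "spare" neighbours such that
--   * every free edge at v goes to a spare neighbour, and
--   * every star having v as a leaf is centred at an earlier or spare vertex.
-- Stars having v as a leaf have pairwise distinct centres (they are
-- edge-disjoint), so v is a leaf of at most d + k - 1 of them; and a k-star
-- centred at c disjoint from all of C would use k free edges at c, more than
-- there are spare neighbours of c, so C is maximal.

open import Defs hiding (sym)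
open import Data.Nat using (ℕ; zero; suc; _≤_; _<_; _+_; _∸_; s≤s; z≤n)
open import Data.Nat.Properties
  using (≤-refl; ≤-trans; ≮⇒≥; +-mono-≤; +-monoˡ-≤; ∸-monoˡ-≤; +-∸-assoc;
         ≤-pred; suc-injective; <-irrefl)
open import Data.Fin using (Fin; zero; suc)
import Data.Fin as Fin
open import Data.Fin.Properties using (_≟_; pigeonhole)
import Data.Fin.Properties as Fin
open import Data.Bool using (Bool; true; false; _∧_; T; T?)
open import Data.Unit using (tt)
open import Data.Empty using (⊥; ⊥-elim)
open import Data.Vec using (Vec; []; _∷_; lookup; toList; replicate; _[_]≔_)
open import Data.Vec.Properties using (lookup∘update; lookup∘update′; lookup-replicate; length-toList)
import Data.Vec.Relation.Unary.Any as VecAny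
import Data.Vec.Relation.Unary.Any.Properties as VecAny
import Data.Vec.Membership.Propositional as VecMembership
open import Data.Vec.Membership.Propositional.Properties
  using (∈-toList⁺; ∈-toList⁻) renaming (∈-lookup to ∈ᵥ-lookup)
import Data.Vec.Membership.DecPropositional as VecDecMembership
open import Data.List using (List; []; _∷_; length; filter; filterᵇ; allFin; _++_)
import Data.List as List
open import Data.List.Properties using (length-++; length-tabulate)
open import Data.List.Relation.Unary.All as All using (All; []; _∷_)
import Data.List.Relation.Unary.All.Properties as All
open import Data.List.Relation.Unary.Any as Any using (Any; here; there)
open import Data.List.Relation.Unary.Any.Properties using (lookup-index)
open import Data.List.Relation.Unary.AllPairs using (AllPairs; []; _∷_)
import Data.List.Relation.Unary.AllPairs.Properties as AllPairs
open import Data.List.Relation.Unary.Unique.Propositional using (Unique)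
import Data.List.Relation.Unary.Unique.Propositional.Properties as Unique
open import Data.List.Membership.Propositional using (_∈_; find)
open import Data.List.Membership.Propositional.Properties
  using (∈-++⁺ˡ; ∈-++⁺ʳ; ∈-++⁻; ∈-filter⁺; ∈-filter⁻; ∈-lookup; ∈-allFin)
open import Data.Product using (_×_; _,_; proj₁; proj₂; Σ; ∃-syntax; ∃₂)
open import Data.Sum using (_⊎_; inj₁; inj₂)
open import Relation.Binary.PropositionalEquality
  using (_≡_; _≢_; refl; sym; trans; cong; subst; module ≡-Reasoning)
open import Relation.Nullary using (¬_; Dec; yes; no)
open import Relation.Nullary.Decidable using (_×-dec_; _⊎-dec_; ¬?)
open import Relation.Unary using (Decidable)
open import Function using (_∘_)

data PrefixView {A : Set} (m : ℕ) (L : List A) : Set where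
  prefix : (v : Vec A m) (r : List A) → L ≡ toList v ++ r → PrefixView m L
  short  : length L < m → PrefixView m L

prefixView : ∀ {A : Set} m (L : List A) → PrefixView m L
prefixView zero    L        = prefix [] L refl
prefixView (suc m) []       = short (s≤s z≤n)
prefixView (suc m) (x ∷ xs) with prefixView m xs
... | prefix v r eq = prefix (x ∷ v) r (cong (x ∷_) eq)
... | short xs<m    = short (s≤s xs<m)

unique-++⁻ : ∀ {A : Set} (xs : List A) {ys : List A} → Unique (xs ++ ys) →
  Unique xs × Unique ys × (∀ {a b} → a ∈ xs → b ∈ ys → a ≢ b)
unique-++⁻ []       u          = [] , u , λ ()
unique-++⁻ (x ∷ xs) (x∉ ∷ u) with unique-++⁻ xs u
... | uxs , uys , apart = All.++⁻ˡ xs x∉ ∷ uxs , uys , apart′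
  where
    apart′ : ∀ {a b} → a ∈ x ∷ xs → b ∈ _ → a ≢ b
    apart′ (here refl) b∈ = All.lookup (All.++⁻ʳ xs x∉) b∈
    apart′ (there a∈)  b∈ = apart a∈ b∈

lookup-injective : ∀ {A : Set} {m} (v : Vec A m) → Unique (toList v) →
  ∀ i j → lookup v i ≡ lookup v j → i ≡ j
lookup-injective (x ∷ v) u        zero    zero    _ = refl
lookup-injective (x ∷ v) (x∉ ∷ u) zero    (suc j) p =
  ⊥-elim (All.lookup x∉ (∈-toList⁺ (∈ᵥ-lookup j v)) p)
lookup-injective (x ∷ v) (x∉ ∷ u) (suc i) zero    p =
  ⊥-elim (All.lookup x∉ (∈-toList⁺ (∈ᵥ-lookup i v)) (sym p))
lookup-injective (x ∷ v) (_ ∷ u)  (suc i) (suc j) p = cong suc (lookup-injective v u i j p)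

∈ᵥ⇒index : ∀ {A : Set} {m} {x : A} {v : Vec A m} → VecMembership._∈_ x v → ∃[ i ] lookup v i ≡ x
∈ᵥ⇒index x∈v = VecAny.index x∈v , sym (VecAny.lookup-index x∈v)

allPairs-lookup : ∀ {A : Set} {R : A → A → Set} {xs : List A} → AllPairs R xs →
  ∀ {p q : Fin (length xs)} → p Fin.< q → R (List.lookup xs p) (List.lookup xs q)
allPairs-lookup (x∼ ∷ _)   {zero}  {suc q} _         = All.lookup x∼ (∈-lookup q)
allPairs-lookup (_  ∷ pw)  {suc p} {suc q} (s≤s p<q) = allPairs-lookup pw p<q

length-≤-by-separation : ∀ {A B : Set} {R : A → A → Set} {xs : List A} {ys : List B}
  (f : A → B) → AllPairs R xs → (∀ {x} → x ∈ xs → f x ∈ ys) →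
  (∀ {x y} → x ∈ xs → y ∈ xs → R x y → f x ≢ f y) → length xs ≤ length ys
length-≤-by-separation {xs = xs} {ys} f related into separates =
  ≮⇒≥ λ ys<xs → collision (pigeonhole ys<xs slot)
  where
    slot : Fin (length xs) → Fin (length ys)
    slot p = Any.index (into (∈-lookup p))

    image : ∀ p → f (List.lookup xs p) ≡ List.lookup ys (slot p)
    image p = lookup-index (into (∈-lookup p))

    collision : ∃₂ (λ p q → p Fin.< q × slot p ≡ slot q) → ⊥
    collision (p , q , p<q , same) =
      separates (∈-lookup p) (∈-lookup q) (allPairs-lookup related p<q) (begin
        f (List.lookup xs p)         ≡⟨ image p ⟩
        List.lookup ys (slot p)      ≡⟨ cong (List.lookup ys) same ⟩
        List.lookup ys (slot q)      ≡⟨ sym (image q) ⟩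
        f (List.lookup xs q)         ∎)
      where open ≡-Reasoning

true≢false : true ≢ false
true≢false ()

both-true : ∀ {a b : Bool} → a ≡ true → b ≡ true → T (a ∧ b)
both-true refl refl = tt

size : ∀ {m} → VSet m → ℕ
size []           = 0
size (true  ∷ S)  = suc (size S)
size (false ∷ S)  = size S

remove : ∀ {m} → VSet m → Fin m → VSet m
remove S v = S [ v ]≔ false

size-remove : ∀ {m} (S : VSet m) {v} → v ∈S S → size S ≡ suc (size (remove S v))
size-remove (true  ∷ S) {zero}  refl = refl
size-remove (false ∷ S) {zero}  ()
size-remove (true  ∷ S) {suc v} v∈S  = cong suc (size-remove S v∈S)
size-remove (false ∷ S) {suc v} v∈S  = size-remove S v∈S

∈-remove⁻ : ∀ {m} (S : VSet m) {u v} → u ∈S remove S v → u ∈S S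
∈-remove⁻ S {u} {v} u∈ with u ≟ v
... | yes refl = ⊥-elim (true≢false (trans (sym u∈) (lookup∘update u S false)))
... | no  u≢v  = trans (sym (lookup∘update′ u≢v S false)) u∈

∈-remove⁺ : ∀ {m} (S : VSet m) {u v} → u ≢ v → u ∈S S → u ∈S remove S v
∈-remove⁺ S u≢v u∈ = trans (lookup∘update′ u≢v S false) u∈

size-zero⇒empty : ∀ {m} (S : VSet m) → size S ≡ 0 → ∀ u → ¬ u ∈S S
size-zero⇒empty (true  ∷ S) ()
size-zero⇒empty (false ∷ S) _  zero    ()
size-zero⇒empty (false ∷ S) sz (suc u) u∈ = size-zero⇒empty S sz u u∈

size-suc⇒nonEmpty : ∀ {m} (S : VSet m) {t} → size S ≡ suc t → NonEmpty S
size-suc⇒nonEmpty (true  ∷ S) _  = zero , refl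
size-suc⇒nonEmpty (false ∷ S) sz with size-suc⇒nonEmpty S sz
... | u , u∈S = suc u , u∈S

sameEdge-swap : ∀ {n} {a b c e : Fin n} → SameEdge a b c e → SameEdge c e a b
sameEdge-swap (inj₁ (p , q)) = inj₁ (sym p , sym q)
sameEdge-swap (inj₂ (p , q)) = inj₂ (sym q , sym p)

sameEdge-flip : ∀ {n} {a b c e : Fin n} → SameEdge a b c e → SameEdge a b e c
sameEdge-flip (inj₁ pq) = inj₂ pq
sameEdge-flip (inj₂ pq) = inj₁ pq

sameEdge? : ∀ {n} (a b c e : Fin n) → Dec (SameEdge a b c e)
sameEdge? a b c e = ((a ≟ c) ×-dec (b ≟ e)) ⊎-dec ((a ≟ e) ×-dec (b ≟ c))

module Packing {n : ℕ} (G : Graph n) (k : ℕ) (k≥1 : 1 ≤ k) where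

  leaf : Star G k → Fin k → Fin n
  leaf s i = lookup (leaves s) i

  IsLeaf : Fin n → Star G k → Set
  IsLeaf u s = ∃[ i ] leaf s i ≡ u

  Free : List (Star G k) → Fin n → Fin n → Set
  Free C a b = All (λ t → ∀ j → ¬ SameEdge (centre t) (leaf t j) a b) C

  free? : ∀ C a b → Dec (Free C a b)
  free? C a b = All.all? (λ t → Fin.all? (λ j → ¬? (sameEdge? _ _ a b))) C

  free-sym : ∀ {C a b} → Free C a b → Free C b a
  free-sym = All.map (λ notEdge j → notEdge j ∘ sameEdge-flip)

  centre≢leaf : ∀ s i → leaf s i ≢ centre s
  centre≢leaf s i leaf≡centre = true≢false (begin
    true                          ≡⟨ sym (isAdj s i) ⟩
    adj G (centre s) (leaf s i)   ≡⟨ cong (adj G (centre s)) leaf≡centre ⟩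
    adj G (centre s) (centre s)   ≡⟨ irrefl G (centre s) ⟩
    false                         ∎)
    where open ≡-Reasoning

  sameCentre-edgeDisjoint : ∀ s t → centre s ≡ centre t →
    (∀ i j → leaf s i ≢ leaf t j) → EdgeDisjoint s t
  sameCentre-edgeDisjoint s t same apart i j (inj₁ (_ , q)) = apart i j q
  sameCentre-edgeDisjoint s t same apart i j (inj₂ (_ , q)) =
    centre≢leaf s i (trans q (sym same))

  record Fan (c : Fin n) (L : List (Fin n)) : Set where
    field
      stars    : List (Star G k)
      leftover : List (Fin n)
      centred  : All (λ s → centre s ≡ c) stars
      leavesIn : All (λ s → ∀ i → leaf s i ∈ L) stars
      disjoint : AllPairs EdgeDisjoint stars
      covers   : ∀ {u} → u ∈ L → Any (IsLeaf u) stars ⊎ u ∈ leftover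
      few      : length leftover < k

  prefix-length : ∀ (v : Vec (Fin n) k) (r : List (Fin n)) → suc (length r) ≤ length (toList v ++ r)
  prefix-length v r = begin
    1 + length r                    ≤⟨ +-monoˡ-≤ (length r) k≥1 ⟩
    k + length r                    ≡⟨ cong (_+ length r) (sym (length-toList v)) ⟩
    length (toList v) + length r    ≡⟨ sym (length-++ (toList v)) ⟩
    length (toList v ++ r)          ∎
    where open Data.Nat.Properties.≤-Reasoning

  fan : (bound : ℕ) (c : Fin n) (L : List (Fin n)) → length L ≤ bound → Unique L →
    All (λ u → adj G c u ≡ true) L → Fan c L
  fan bound c L _ _ _ with prefixView k L
  fan bound c L _ _ _ | short L<k = record
    { stars = [] ; leftover = L ; centred = [] ; leavesIn = [] ; disjoint = []
    ; covers = inj₂ ; few = L<k }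
  fan zero c .(toList v ++ r) L≤0 _ _ | prefix v r refl
    with () ← ≤-trans (prefix-length v r) L≤0
  fan (suc bound) c .(toList v ++ r) L≤ unique adjacent | prefix v r refl = record
    { stars    = s ∷ F.stars
    ; leftover = F.leftover
    ; centred  = refl ∷ F.centred
    ; leavesIn = (λ i → ∈-++⁺ˡ (∈-toList⁺ (∈ᵥ-lookup i v)))
                 ∷ All.map (λ inR i → ∈-++⁺ʳ (toList v) (inR i)) F.leavesIn
    ; disjoint = All.tabulate s-disjoint ∷ F.disjoint
    ; covers   = covers
    ; few      = F.few }
    where
      split : Unique (toList v) × Unique r × (∀ {a b} → a ∈ toList v → b ∈ r → a ≢ b)
      split = unique-++⁻ (toList v) unique
      s : Star G k
      s = star c v (lookup-injective v (proj₁ split))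
            (λ i → All.lookup (All.++⁻ˡ (toList v) adjacent) (∈-toList⁺ (∈ᵥ-lookup i v)))
      module F = Fan (fan bound c r (≤-pred (≤-trans (prefix-length v r) L≤))
                        (proj₁ (proj₂ split)) (All.++⁻ʳ (toList v) adjacent))
      s-disjoint : ∀ {t} → t ∈ F.stars → EdgeDisjoint s t
      s-disjoint {t} t∈ = sameCentre-edgeDisjoint s t (sym (All.lookup F.centred t∈))
        (λ i j → proj₂ (proj₂ split) (∈-toList⁺ (∈ᵥ-lookup i v)) (All.lookup F.leavesIn t∈ j))
      covers : ∀ {u} → u ∈ toList v ++ r → Any (IsLeaf u) (s ∷ F.stars) ⊎ u ∈ F.leftover
      covers u∈ with ∈-++⁻ (toList v) u∈
      ... | inj₁ u∈v = inj₁ (here (∈ᵥ⇒index (∈-toList⁻ u∈v)))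
      ... | inj₂ u∈r with F.covers u∈r
      ...   | inj₁ leafOfSome = inj₁ (there leafOfSome)
      ...   | inj₂ spare      = inj₂ spare

  record Witness (d : ℕ) (v : Fin n) (C : List (Star G k)) : Set where
    field
      earlier spare : List (Fin n)
      few-earlier   : length earlier ≤ d
      few-spare     : length spare < k
      free⇒spare    : ∀ {w} → adj G v w ≡ true → Free C v w → w ∈ spare
      leaf⇒centre   : ∀ {s} → s ∈ C → IsLeaf v s → centre s ∈ earlier ++ spare

  -- A k-star at c edge-disjoint from C would have its k distinct leaves among
  -- the fewer than k spare vertices of c; so certificates everywhere give maximality.
  witnessed⇒maximal : ∀ {d C} → (∀ v → Witness d v C) → Maximal C
  witnessed⇒maximal witness s avoidsC = <-irrefl refl (begin-strict
    k                    ≡⟨ sym (length-tabulate (λ i → i)) ⟩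
    length (allFin k)    ≤⟨ length-≤-by-separation (leaf s) (Unique.allFin⁺ k) leafIsSpare
                              (λ _ _ i≢j → i≢j ∘ distinct s _ _) ⟩
    length W.spare       <⟨ W.few-spare ⟩
    k                    ∎)
    where
      open Data.Nat.Properties.≤-Reasoning
      module W = Witness (witness (centre s))
      leafIsSpare : ∀ {i} → i ∈ allFin k → leaf s i ∈ W.spare
      leafIsSpare {i} _ =
        W.free⇒spare (isAdj s i) (All.map (λ disjoint j → disjoint i j ∘ sameEdge-swap) avoidsC)

  -- The stars of a packing having v as a leaf have pairwise distinct centres
  -- (two of them with a common centre would share an edge), all lying in
  -- earlier ++ spare; hence v is a leaf of at most d + k - 1 of them.
  endCount-bound : ∀ {d C v} → AllPairs EdgeDisjoint C → Witness d v C →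
    endCount v C ≤ d + k ∸ 1
  endCount-bound {d} {C} {v} disjoint W = begin
    endCount v C                        ≤⟨ length-≤-by-separation centre
                                             (AllPairs.filter⁺ hasLeaf? disjoint) centreIn distinctCentres ⟩
    length (W.earlier ++ W.spare)       ≡⟨ length-++ W.earlier ⟩
    length W.earlier + length W.spare   ≤⟨ +-mono-≤ W.few-earlier (∸-monoˡ-≤ 1 W.few-spare) ⟩
    d + (k ∸ 1)                         ≡⟨ sym (+-∸-assoc d k≥1) ⟩
    d + k ∸ 1                           ∎
    where
      open Data.Nat.Properties.≤-Reasoning
      module W = Witness W
      hasLeaf? : (s : Star G k) → Dec (VecMembership._∈_ v (leaves s))
      hasLeaf? s = VecDecMembership._∈?_ _≟_ v (leaves s)
      member : ∀ {s} → s ∈ filter hasLeaf? C → s ∈ C × IsLeaf v s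
      member s∈ with ∈-filter⁻ hasLeaf? {xs = C} s∈
      ... | s∈C , v∈s = s∈C , ∈ᵥ⇒index v∈s
      centreIn : ∀ {s} → s ∈ filter hasLeaf? C → centre s ∈ W.earlier ++ W.spare
      centreIn s∈ = W.leaf⇒centre (proj₁ (member s∈)) (proj₂ (member s∈))
      distinctCentres : ∀ {s t} → s ∈ filter hasLeaf? C → t ∈ filter hasLeaf? C →
        EdgeDisjoint s t → centre s ≢ centre t
      distinctCentres s∈ t∈ disjoint sameCentre with member s∈ | member t∈
      ... | _ , i , sᵢ≡v | _ , j , tⱼ≡v = disjoint i j (inj₁ (sameCentre , trans sᵢ≡v (sym tⱼ≡v)))

  record Invariant (d : ℕ) (S : VSet n) (C : List (Star G k)) : Set where
    field
      disjoint  : AllPairs EdgeDisjoint C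
      centredIn : All (λ s → centre s ∈S S) C
      witness   : ∀ {v} → v ∈S S → Witness d v C

  module Extend {d : ℕ} {S : VSet n} {v : Fin n} (v∈S : v ∈S S) (deg-v : degIn G S v ≤ d)
                {C : List (Star G k)} (inv : Invariant d (remove S v) C) where

    module I = Invariant inv

    Open : Fin n → Set
    Open u = adj G v u ≡ true × Free C v u

    open? : Decidable Open
    open? u = (adj G v u Data.Bool.≟ true) ×-dec free? C v u

    openNeighbours : List (Fin n)
    openNeighbours = filter open? (allFin n)

    open⁻ : ∀ {u} → u ∈ openNeighbours → Open u
    open⁻ u∈ = proj₂ (∈-filter⁻ open? {xs = allFin n} u∈)

    open⁺ : ∀ {u} → Open u → u ∈ openNeighbours
    open⁺ {u} = ∈-filter⁺ open? (∈-allFin u)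

    module F = Fan (fan (length openNeighbours) v openNeighbours ≤-refl
                     (Unique.filter⁺ open? (Unique.allFin⁺ n)) (All.tabulate (proj₁ ∘ open⁻)))

    extendedC : List (Star G k)
    extendedC = F.stars ++ C

    -- The new stars use only free edges, so they avoid the old ones.
    fan-avoids-C : All (λ s → All (EdgeDisjoint s) C) F.stars
    fan-avoids-C = All.tabulate λ {s} s∈ → All.tabulate λ {t} t∈ i j shared →
      All.lookup (proj₂ (open⁻ (All.lookup F.leavesIn s∈ i))) t∈ j
        (subst (λ x → SameEdge (centre t) (leaf t j) x (leaf s i))
               (All.lookup F.centred s∈) (sameEdge-swap shared))

    -- The earlier vertices of v are its at most d neighbours in S; all free
    -- edges left at v go to leftovers of the fan.
    witness-v : Witness d v extendedC
    witness-v = record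
      { earlier = filterᵇ (λ w → lookup S w ∧ adj G v w) (allFin n)
      ; spare = F.leftover ; few-earlier = deg-v ; few-spare = F.few
      ; free⇒spare = free⇒spare ; leaf⇒centre = leaf⇒centre }
      where
        free⇒spare : ∀ {w} → adj G v w ≡ true → Free extendedC v w → w ∈ F.leftover
        free⇒spare {w} v∼w free with F.covers (open⁺ (v∼w , All.++⁻ʳ F.stars free))
        ... | inj₂ spare = spare
        ... | inj₁ leafOfFan with find leafOfFan
        ...   | s , s∈ , i , sᵢ≡w =
                ⊥-elim (All.lookup free (∈-++⁺ˡ s∈) i (inj₁ (All.lookup F.centred s∈ , sᵢ≡w)))
        leaf⇒centre : ∀ {s} → s ∈ extendedC → IsLeaf v s →
          centre s ∈ filterᵇ (λ w → lookup S w ∧ adj G v w) (allFin n) ++ F.leftover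
        leaf⇒centre {s} s∈ (i , sᵢ≡v) with ∈-++⁻ F.stars s∈
        ... | inj₁ s∈F = ⊥-elim (centre≢leaf s i (trans sᵢ≡v (sym (All.lookup F.centred s∈F))))
        ... | inj₂ s∈C = ∈-++⁺ˡ (∈-filter⁺ (T? ∘ _) (∈-allFin (centre s))
                (both-true (∈-remove⁻ S (All.lookup I.centredIn s∈C))
                           (trans (Graph.sym G v (centre s))
                                  (subst (λ x → adj G (centre s) x ≡ true) sᵢ≡v (isAdj s i)))))

    -- At any other vertex u the old certificate survives: a new star with leaf
    -- u is centred at v, and the edge uv was free, so v was spare at u.
    witness-other : ∀ {u} → u ≢ v → u ∈S S → Witness d u extendedC
    witness-other {u} u≢v u∈S = record
      { earlier = W.earlier ; spare = W.spare ; few-earlier = W.few-earlier ; few-spare = W.few-spare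
      ; free⇒spare = λ u∼w free → W.free⇒spare u∼w (All.++⁻ʳ F.stars free)
      ; leaf⇒centre = leaf⇒centre }
      where
        module W = Witness (I.witness (∈-remove⁺ S u≢v u∈S))
        leaf⇒centre : ∀ {s} → s ∈ extendedC → IsLeaf u s → centre s ∈ W.earlier ++ W.spare
        leaf⇒centre {s} s∈ (i , sᵢ≡u) with ∈-++⁻ F.stars s∈
        ... | inj₂ s∈C = W.leaf⇒centre s∈C (i , sᵢ≡u)
        ... | inj₁ s∈F with subst Open sᵢ≡u (open⁻ (All.lookup F.leavesIn s∈F i))
        ...   | v∼u , free = subst (_∈ W.earlier ++ W.spare) (sym (All.lookup F.centred s∈F))
                  (∈-++⁺ʳ W.earlier (W.free⇒spare (trans (Graph.sym G u v) v∼u) (free-sym free)))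

    extended : Invariant d S extendedC
    extended = record
      { disjoint  = AllPairs.++⁺ F.disjoint I.disjoint fan-avoids-C
      ; centredIn = All.++⁺ (All.map (λ c≡v → subst (_∈S S) (sym c≡v) v∈S) F.centred)
                            (All.map (∈-remove⁻ S) I.centredIn)
      ; witness   = witness }
      where
        witness : ∀ {u} → u ∈S S → Witness d u extendedC
        witness {u} u∈S with u ≟ v
        ... | yes refl = witness-v
        ... | no  u≢v  = witness-other u≢v u∈S

  build : (d : ℕ) → (∀ (S : VSet n) → NonEmpty S → ∃[ v ] (v ∈S S × degIn G S v ≤ d)) →
    ∀ m (S : VSet n) → size S ≡ m → Σ (List (Star G k)) (Invariant d S)
  build d degenerate zero S empty = [] , record
    { disjoint = [] ; centredIn = []
    ; witness = λ {u} u∈S → ⊥-elim (size-zero⇒empty S empty u u∈S) }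
  build d degenerate (suc m) S sz with degenerate S (size-suc⇒nonEmpty S sz)
  ... | v , v∈S , deg-v with build d degenerate m (remove S v)
                                (suc-injective (trans (sym (size-remove S v∈S)) sz))
  ...   | C , inv = Extend.extendedC v∈S deg-v inv , Extend.extended v∈S deg-v inv

-- The theorem.  Only the upper half of the degeneracy hypothesis (every
-- non-empty induced subgraph has a vertex of degree at most d) is needed.
proposition9 : ∀ {n} (G : Graph n) (k d : ℕ) → 1 ≤ k → IsDegeneracy G d →
    ∃[ C ] (PairwiseEdgeDisjoint {G = G} {k} C × Maximal C
      × (∀ (v : Fin n) → endCount v C ≤ d + k ∸ 1))
proposition9 {n} G k d k≥1 (degenerate , _) =
  C , disjoint , witnessed⇒maximal witnessEverywhere
    , λ v → endCount-bound disjoint (witnessEverywhere v)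
  where
    open Packing G k k≥1
    everything : VSet n
    everything = replicate n true
    packing : Σ (List (Star G k)) (Invariant d everything)
    packing = build d degenerate (size everything) everything refl
    C : List (Star G k)
    C = proj₁ packing
    open Invariant (proj₂ packing)
    witnessEverywhere : ∀ v → Witness d v C
    witnessEverywhere v = witness (lookup-replicate v true)
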